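{- Let $Q$ be the $5\times 5$ permutation matrix whose $1$ entries are exactly at positions (row, column) $(1,2),(2,5),(3,3),(4,1),(5,4)$. Then $sat(Q,n)<400$ for every positive integer $n$.
   Context: All matrices are $0$-$1$ matrices; an $m\times n$ matrix has $m$ rows and $n$ columns. The weight of a matrix is its number of $1$ entries. A matrix $M$ contains a $k\times l$ pattern $P$ if there are rows $r_1<\dots<r_k$ and columns $c_1<\dots<c_l$ of $M$ such that $M(r_a,c_b)=1$ whenever $P(a,b)=1$; otherwise $M$ avoids $P$. A matrix $M$ is saturating for $P$ if $M$ avoids $P$ and changing any single $0$ entry of $M$ to $1$ yields a matrix containing $P$. $sat(P,m,n)$ is the minimum weight of an $m\times n$ matrix saturating for $P$, and $sat(P,n)=sat(P,n,n)$. -}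

module Defs where

open import Data.Nat using (ℕ; zero; suc; _+_; _<_)
open import Data.Bool using (Bool; true; false; if_then_else_)
open import Data.Fin using (Fin; toℕ) renaming (_<_ to _<ᶠ_)
open import Data.Fin.Patterns
open import Data.Product using (Σ; _×_; _,_; ∃)
open import Relation.Binary.PropositionalEquality using (_≡_)
open import Relation.Nullary using (¬_)

-- An m×n 0-1 matrix: entry (i , j) for row i, column j (0-indexed); true = 1.
Matrix : ℕ → ℕ → Set
Matrix m n = Fin m → Fin n → Bool

sumFin : (n : ℕ) → (Fin n → ℕ) → ℕ
sumFin zero    f = 0
sumFin (suc n) f = f Fin.zero + sumFin n (λ i → f (Fin.suc i))

weight : ∀ {m n} → Matrix m n → ℕ
weight {m} {n} M = sumFin m (λ i → sumFin n (λ j → if M i j then 1 else 0))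

StrictlyIncreasing : ∀ {k m} → (Fin k → Fin m) → Set
StrictlyIncreasing f = ∀ a b → a <ᶠ b → f a <ᶠ f b

Contains : ∀ {m n k l} → Matrix m n → Matrix k l → Set
Contains {m} {n} {k} {l} M P =
  Σ (Fin k → Fin m) λ r → Σ (Fin l → Fin n) λ c →
    StrictlyIncreasing r × StrictlyIncreasing c ×
    (∀ a b → P a b ≡ true → M (r a) (c b) ≡ true)

Avoids : ∀ {m n k l} → Matrix m n → Matrix k l → Set
Avoids M P = ¬ Contains M P

flipOn : ∀ {m n} → Matrix m n → Fin m → Fin n → Matrix m n
flipOn M i j i' j' with i Data.Fin.≟ i' | j Data.Fin.≟ j'
... | Relation.Nullary.yes _ | Relation.Nullary.yes _ = true
... | _ | _ = M i' j'

Saturating : ∀ {m n k l} → Matrix m n → Matrix k l → Set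
Saturating M P = Avoids M P ×
  (∀ i j → M i j ≡ false → Contains (flipOn M i j) P)

-- Q: 1 entries at (1,2),(2,5),(3,3),(4,1),(5,4) (1-indexed); here 0-indexed.
Q : Matrix 5 5
Q 0F 1F = true
Q 1F 4F = true
Q 2F 2F = true
Q 3F 0F = true
Q 4F 3F = true
Q _  _  = false

-- For n ≥ 10 start from the 10 × 10 matrix W below, of weight 56, whose fifth row and sixth
-- column are empty: it avoids Q (by exhaustive search) and each of its 0s, turned into a 1,
-- completes an explicitly listed copy of Q. Since Q has a 1 in every row and every column,
-- doubling an empty row and an empty column of a saturating matrix (pulling it back along
-- pinch maps) keeps it saturating without changing its weight, so W grows to every size
-- n ≥ 10 with weight 56. For n ≤ 9 any saturating matrix will do, as its weight is at most
-- n² ≤ 81; one is built greedily by adding 1s as long as Q stays avoided, since a rejected 0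
-- stays witnessed when further 1s are added.
module Submission where

open import Defs
open import Data.Bool using (Bool; true; false; if_then_else_)
open import Data.Bool.Properties using () renaming (_≟_ to _≟ᵇ_)
open import Data.Fin using (Fin; zero; suc; inject₁; pinch)
  renaming (_<_ to _<ᶠ_; _≤_ to _≤ᶠ_)
open import Data.Fin.Patterns
open import Data.Fin.Properties
  using (any?; all?; <-trans; ≤∧≢⇒<; pinch-mono-≤; pinch-surjective)
  renaming (_≟_ to _≟ᶠ_; _<?_ to _<ᶠ?_)
open import Data.List using (List; []; _∷_; foldl; allFin; cartesianProduct)
open import Data.List.Membership.Propositional using (_∈_)
open import Data.List.Membership.Propositional.Properties using (∈-allFin; ∈-cartesianProduct⁺)
open import Data.List.Relation.Unary.Any using (Any; here; there; satisfied) renaming (any? to anyᴸ?)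
open import Data.Nat using (ℕ; zero; suc; _+_; _*_; _≤_; _<_; _<?_; z≤n; s≤s; z<s; s<s; s<s⁻¹)
open import Data.Nat.Properties
  using (+-commutativeSemigroup; ≤-trans; ≤-reflexive; ≤-<-trans; <⇒≱; +-mono-≤; *-mono-≤; *-identityʳ; +-comm; ≮⇒≥; m≤n⇒∃[o]m+o≡n)
open import Algebra.Properties.CommutativeSemigroup +-commutativeSemigroup
  using (x∙yz≈y∙xz)
open import Data.Product using (Σ; ∃-syntax; _×_; _,_; proj₁; proj₂)
open import Data.Sum using (_⊎_; inj₁; inj₂)
open import Data.Vec using (Vec; []; _∷_; lookup)
open import Function using (_∘_)
open import Function.Definitions using (Surjective)
open import Relation.Binary.Definitions using (Monotonic₁)
open import Relation.Binary.PropositionalEquality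
  using (_≡_; _≢_; refl; sym; trans; cong; cong₂; subst; subst₂; module ≡-Reasoning)
open import Relation.Nullary using (Dec; does; yes; no; ¬_; contradiction)
open import Relation.Nullary.Decidable using (_×-dec_; _→-dec_; map′; from-yes)

private
  variable
    k l m n s t : ℕ

_⊆_ : Matrix m n → Matrix m n → Set
M ⊆ N = ∀ i j → M i j ≡ true → N i j ≡ true

contains-mono : {M N : Matrix m n} {P : Matrix k l} → M ⊆ N → Contains M P → Contains N P
contains-mono M⊆N (r , c , r↑ , c↑ , hit) = r , c , r↑ , c↑ , λ a b p → M⊆N (r a) (c b) (hit a b p)

flipOn-hit : (M : Matrix m n) (i : Fin m) (j : Fin n) → flipOn M i j i j ≡ true
flipOn-hit M i j with i ≟ᶠ i | j ≟ᶠ j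
... | yes _   | yes _   = refl
... | yes _   | no j≢j  = contradiction refl j≢j
... | no i≢i  | _       = contradiction refl i≢i

⊆-flipOn : (M : Matrix m n) (i : Fin m) (j : Fin n) → M ⊆ flipOn M i j
⊆-flipOn M i j x y M-hit with i ≟ᶠ x | j ≟ᶠ y
... | yes _ | yes _ = refl
... | yes _ | no _  = M-hit
... | no _  | _     = M-hit

flipOn-mono : {M N : Matrix m n} {i : Fin m} {j : Fin n} → M ⊆ N → flipOn M i j ⊆ flipOn N i j
flipOn-mono {i = i} {j} M⊆N x y hit with i ≟ᶠ x | j ≟ᶠ y
... | yes _ | yes _ = refl
... | yes _ | no _  = M⊆N x y hit
... | no _  | _     = M⊆N x y hit

flipOn-true : {M : Matrix m n} {i x : Fin m} {j y : Fin n} →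
              flipOn M i j x y ≡ true → (i ≡ x × j ≡ y) ⊎ M x y ≡ true
flipOn-true {i = i} {x} {j} {y} hit with i ≟ᶠ x | j ≟ᶠ y
... | yes i≡x | yes j≡y = inj₁ (i≡x , j≡y)
... | yes _   | no _    = inj₂ hit
... | no _    | _       = inj₂ hit

empty-avoids : {P : Matrix k l} {a : Fin k} {b : Fin l} → P a b ≡ true → Avoids {m} {n} (λ _ _ → false) P
empty-avoids P-hit (_ , _ , _ , _ , hit) with hit _ _ P-hit
... | ()

-- Saturating matrices exist in every size

module Greedy {P : Matrix k l} (contains? : (M : Matrix m n) → Dec (Contains M P)) where

  Settled : Matrix m n → Fin m × Fin n → Set
  Settled M (i , j) = M i j ≡ true ⊎ Contains (flipOn M i j) P

  settled-mono : {M N : Matrix m n} {p : Fin m × Fin n} → M ⊆ N → Settled M p → Settled N p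
  settled-mono {p = i , j} M⊆N (inj₁ hit) = inj₁ (M⊆N i j hit)
  settled-mono {p = i , j} M⊆N (inj₂ occ) = inj₂ (contains-mono (flipOn-mono {i = i} {j} M⊆N) occ)

  insertIfAvoiding : Matrix m n → Fin m × Fin n → Matrix m n
  insertIfAvoiding M (i , j) with contains? (flipOn M i j)
  ... | yes _ = M
  ... | no _  = flipOn M i j

  insert-avoids : (M : Matrix m n) (p : Fin m × Fin n) → Avoids M P → Avoids (insertIfAvoiding M p) P
  insert-avoids M (i , j) M-avoids with contains? (flipOn M i j)
  ... | yes _      = M-avoids
  ... | no avoids  = avoids

  ⊆-insert : (M : Matrix m n) (p : Fin m × Fin n) → M ⊆ insertIfAvoiding M p
  ⊆-insert M (i , j) with contains? (flipOn M i j)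
  ... | yes _ = λ _ _ hit → hit
  ... | no _  = ⊆-flipOn M i j

  insert-settles : (M : Matrix m n) (p : Fin m × Fin n) → Settled (insertIfAvoiding M p) p
  insert-settles M (i , j) with contains? (flipOn M i j)
  ... | yes occ = inj₂ occ
  ... | no _    = inj₁ (flipOn-hit M i j)

  greedy : List (Fin m × Fin n) → Matrix m n → Matrix m n
  greedy ps M = foldl insertIfAvoiding M ps

  greedy-avoids : ∀ ps (M : Matrix m n) → Avoids M P → Avoids (greedy ps M) P
  greedy-avoids []       M avoids = avoids
  greedy-avoids (p ∷ ps) M avoids = greedy-avoids ps (insertIfAvoiding M p) (insert-avoids M p avoids)

  ⊆-greedy : ∀ ps (M : Matrix m n) → M ⊆ greedy ps M
  ⊆-greedy []       M i j hit = hit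
  ⊆-greedy (p ∷ ps) M i j hit = ⊆-greedy ps (insertIfAvoiding M p) i j (⊆-insert M p i j hit)

  greedy-settles : ∀ ps (M : Matrix m n) {p} → p ∈ ps → Settled (greedy ps M) p
  greedy-settles (p ∷ ps) M (here refl) =
    settled-mono (⊆-greedy ps (insertIfAvoiding M p)) (insert-settles M p)
  greedy-settles (_ ∷ ps) M (there p∈ps) = greedy-settles ps (insertIfAvoiding _ _) p∈ps

  saturating-exists : {a : Fin k} {b : Fin l} → P a b ≡ true → Σ (Matrix m n) λ M → Saturating M P
  saturating-exists P-hit = G , greedy-avoids positions _ (empty-avoids P-hit) , settled-flips
    where
    positions : List (Fin m × Fin n)
    positions = cartesianProduct (allFin m) (allFin n)

    G : Matrix m n
    G = greedy positions (λ _ _ → false)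

    settled-flips : ∀ i j → G i j ≡ false → Contains (flipOn G i j) P
    settled-flips i j G-miss
      with greedy-settles positions _ (∈-cartesianProduct⁺ (∈-allFin i) (∈-allFin j))
    ... | inj₁ G-hit = contradiction (trans (sym G-hit) G-miss) λ ()
    ... | inj₂ occ   = occ

-- Weights and pullbacks

sumFin-cong : {f g : Fin n → ℕ} → (∀ i → f i ≡ g i) → sumFin n f ≡ sumFin n g
sumFin-cong {zero}  f≡g = refl
sumFin-cong {suc n} f≡g = cong₂ _+_ (f≡g zero) (sumFin-cong (f≡g ∘ suc))

sumFin-zero : {f : Fin n → ℕ} → (∀ i → f i ≡ 0) → sumFin n f ≡ 0
sumFin-zero {zero}  f≡0 = refl
sumFin-zero {suc n} f≡0 = cong₂ _+_ (f≡0 zero) (sumFin-zero (f≡0 ∘ suc))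

sumFin-≤ : {f : Fin n → ℕ} {b : ℕ} → (∀ i → f i ≤ b) → sumFin n f ≤ n * b
sumFin-≤ {zero}  f≤b = z≤n
sumFin-≤ {suc n} f≤b = +-mono-≤ (f≤b zero) (sumFin-≤ (f≤b ∘ suc))

sumFin-pinch : (i : Fin n) (f : Fin n → ℕ) → sumFin (suc n) (f ∘ pinch i) ≡ f i + sumFin n f
sumFin-pinch {suc n} zero    f = refl
sumFin-pinch {suc n} (suc i) f = begin
  f zero + sumFin (suc n) (f ∘ suc ∘ pinch i)  ≡⟨ cong (f zero +_) (sumFin-pinch i (f ∘ suc)) ⟩
  f zero + (f (suc i) + sumFin n (f ∘ suc))    ≡⟨ x∙yz≈y∙xz (f zero) (f (suc i)) _ ⟩
  f (suc i) + (f zero + sumFin n (f ∘ suc))    ∎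
  where open ≡-Reasoning

weight-≤ : (M : Matrix m n) → weight M ≤ m * n
weight-≤ {m} {n} M = sumFin-≤ λ i → ≤-trans (sumFin-≤ (entry≤1 ∘ M i)) (≤-reflexive (*-identityʳ n))
  where
  entry≤1 : (b : Bool) → (if b then 1 else 0) ≤ 1
  entry≤1 true  = s≤s z≤n
  entry≤1 false = z≤n

NoZeroLine : Matrix k l → Set
NoZeroLine P = (∀ a → ∃[ b ] P a b ≡ true) × (∀ b → ∃[ a ] P a b ≡ true)

monotone-reflects-< : {φ : Fin s → Fin m} → Monotonic₁ _≤ᶠ_ _≤ᶠ_ φ → ∀ {x y} → φ x <ᶠ φ y → x <ᶠ y
monotone-reflects-< φ-mono {x} {y} φx<φy with x <ᶠ? y
... | yes x<y = x<y
... | no x≮y  = contradiction (φ-mono (≮⇒≥ x≮y)) (<⇒≱ φx<φy)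

pullback : Matrix m n → (Fin s → Fin m) → (Fin t → Fin n) → Matrix s t
pullback M φ ψ i j = M (φ i) (ψ j)

IncreasingAwayFrom : (Fin s → Fin m) → Fin m → Set
IncreasingAwayFrom φ r = ∀ {x y} → x <ᶠ y → φ y ≢ r → φ x <ᶠ φ y

occupied-row≢empty-row : {M : Matrix m n} {x r : Fin m} {y : Fin n} →
                       (∀ j → M r j ≡ false) → M x y ≡ true → x ≢ r
occupied-row≢empty-row {M = M} {y = y} r-empty hit refl with trans (sym hit) (r-empty y)
... | ()

-- As P has no zero line, an occurrence of P in the pullback meets no row sent to r and no
-- column sent to c, and away from those φ and ψ are strictly increasing.
pullback-avoids : {M : Matrix m n} {P : Matrix k l} {φ : Fin s → Fin m} {ψ : Fin t → Fin n} {r : Fin m} {c : Fin n} →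
                  NoZeroLine P → (∀ j → M r j ≡ false) → (∀ i → M i c ≡ false) →
                  IncreasingAwayFrom φ r → IncreasingAwayFrom ψ c →
                  Avoids M P → Avoids (pullback M φ ψ) P
pullback-avoids {M = M} {φ = φ} {ψ} (rows-full , columns-full) r-empty c-empty φ↑ ψ↑ avoids
                (ρ , γ , ρ↑ , γ↑ , hit) =
  avoids (φ ∘ ρ , ψ ∘ γ , φρ↑ , ψγ↑ , hit)
  where
  φρ↑ : StrictlyIncreasing (φ ∘ ρ)
  φρ↑ a b a<b = φ↑ (ρ↑ a b a<b) (occupied-row≢empty-row {M = M} r-empty (hit b _ (proj₂ (rows-full b))))

  ψγ↑ : StrictlyIncreasing (ψ ∘ γ)
  ψγ↑ a b a<b = ψ↑ (γ↑ a b a<b) λ ψγb≡c →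
    occupied-row≢empty-row {M = λ j i → M i j} c-empty (hit _ b (proj₂ (columns-full b))) ψγb≡c

module _ {φ : Fin s → Fin m} (φ-onto : Surjective _≡_ _≡_ φ) (i : Fin s) where

  -- Choosing i as the preimage of φ i makes the flipped entry of M lift to the flipped entry (i , j).
  preimage : Fin m → Fin s
  preimage x with x ≟ᶠ φ i
  ... | yes _ = i
  ... | no _  = proj₁ (φ-onto x)

  φ-preimage : ∀ x → φ (preimage x) ≡ x
  φ-preimage x with x ≟ᶠ φ i
  ... | yes x≡φi = sym x≡φi
  ... | no _     = proj₂ (φ-onto x) refl

  preimage-φ : ∀ {x} → φ i ≡ x → preimage x ≡ i
  preimage-φ {x} φi≡x with x ≟ᶠ φ i
  ... | yes _    = refl
  ... | no x≢φi  = contradiction (sym φi≡x) x≢φi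

pullback-flips : {M : Matrix m n} {P : Matrix k l} {φ : Fin s → Fin m} {ψ : Fin t → Fin n} →
                 Monotonic₁ _≤ᶠ_ _≤ᶠ_ φ → Monotonic₁ _≤ᶠ_ _≤ᶠ_ ψ →
                 (φ-onto : Surjective _≡_ _≡_ φ) (ψ-onto : Surjective _≡_ _≡_ ψ) →
                 ∀ i j → Contains (flipOn M (φ i) (ψ j)) P → Contains (flipOn (pullback M φ ψ) i j) P
pullback-flips {M = M} {P} {φ} {ψ} φ-mono ψ-mono φ-onto ψ-onto i j (ρ , γ , ρ↑ , γ↑ , hit) =
  ρ′ , γ′ , ρ′↑ , γ′↑ , hit′
  where
  ρ′ = preimage φ-onto i ∘ ρ
  γ′ = preimage ψ-onto j ∘ γ
  N = pullback M φ ψ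

  ρ′↑ : StrictlyIncreasing ρ′
  ρ′↑ a b a<b = monotone-reflects-< φ-mono
    (subst₂ _<ᶠ_ (sym (φ-preimage φ-onto i (ρ a))) (sym (φ-preimage φ-onto i (ρ b))) (ρ↑ a b a<b))

  γ′↑ : StrictlyIncreasing γ′
  γ′↑ a b a<b = monotone-reflects-< ψ-mono
    (subst₂ _<ᶠ_ (sym (φ-preimage ψ-onto j (γ a))) (sym (φ-preimage ψ-onto j (γ b))) (γ↑ a b a<b))

  hit′ : ∀ a b → P a b ≡ true → flipOn N i j (ρ′ a) (γ′ b) ≡ true
  hit′ a b P-hit with flipOn-true (hit a b P-hit)
  ... | inj₁ (φi≡ρa , ψj≡γb) =
    subst₂ (λ x y → flipOn N i j x y ≡ true)
      (sym (preimage-φ φ-onto i φi≡ρa)) (sym (preimage-φ ψ-onto j ψj≡γb)) (flipOn-hit N i j)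
  ... | inj₂ M-hit =
    ⊆-flipOn N i j _ _
      (subst₂ (λ x y → M x y ≡ true) (sym (φ-preimage φ-onto i (ρ a))) (sym (φ-preimage ψ-onto j (γ b))) M-hit)

pinch-increasing : (i : Fin n) → IncreasingAwayFrom (pinch i) i
pinch-increasing {suc n} zero    {zero}  {suc y} _   y≢0 = ≤∧≢⇒< z≤n (y≢0 ∘ sym)
pinch-increasing {suc n} (suc i) {zero}  {suc y} _   _   = z<s
pinch-increasing {suc n} zero    {suc x} {suc y} x<y _   = s<s⁻¹ x<y
pinch-increasing {suc n} (suc i) {suc x} {suc y} x<y ne  = s<s (pinch-increasing i (s<s⁻¹ x<y) (ne ∘ cong suc))

pinch-suc : (i : Fin n) → pinch i (suc i) ≡ i
pinch-suc {suc n} zero    = refl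
pinch-suc {suc n} (suc i) = cong suc (pinch-suc i)

record EmptyCross (M : Matrix m n) : Set where
  field
    row          : Fin m
    column       : Fin n
    row-empty    : ∀ j → M row j ≡ false
    column-empty : ∀ i → M i column ≡ false

module _ (M : Matrix m n) (cross : EmptyCross M) where
  open EmptyCross cross

  duplicate : Matrix (suc m) (suc n)
  duplicate = pullback M (pinch row) (pinch column)

  duplicate-emptyCross : EmptyCross duplicate
  duplicate-emptyCross = record
    { row          = suc row
    ; column       = suc column
    ; row-empty    = λ j → subst (λ x → M x (pinch column j) ≡ false) (sym (pinch-suc row)) (row-empty _)
    ; column-empty = λ i → subst (λ y → M (pinch row i) y ≡ false) (sym (pinch-suc column)) (column-empty _)
    }

  duplicate-saturating : {P : Matrix k l} → NoZeroLine P → Saturating M P → Saturating duplicate P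
  duplicate-saturating P-lines (avoids , flips) =
    pullback-avoids P-lines row-empty column-empty
      (pinch-increasing row) (pinch-increasing column) avoids ,
    λ i j miss → pullback-flips (pinch-mono-≤ row) (pinch-mono-≤ column)
      (pinch-surjective row) (pinch-surjective column) i j (flips _ _ miss)

  weight-duplicate : weight duplicate ≡ weight M
  weight-duplicate = begin
    sumFin (suc m) (λ i → sumFin (suc n) (λ j → entry (pinch row i) (pinch column j)))
      ≡⟨ sumFin-cong (λ i → sumFin-pinch column (entry (pinch row i))) ⟩
    sumFin (suc m) (λ i → entry (pinch row i) column + sumFin n (entry (pinch row i)))
      ≡⟨ sumFin-cong (λ i → cong (_+ sumFin n (entry (pinch row i))) (column-zero (pinch row i))) ⟩
    sumFin (suc m) (λ i → sumFin n (entry (pinch row i)))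
      ≡⟨ sumFin-pinch row (λ i → sumFin n (entry i)) ⟩
    sumFin n (entry row) + weight M
      ≡⟨ cong (_+ weight M) (sumFin-zero row-zero) ⟩
    weight M ∎
    where
    open ≡-Reasoning
    count : Bool → ℕ
    count b = if b then 1 else 0
    entry : Fin m → Fin n → ℕ
    entry i j = count (M i j)
    row-zero : ∀ j → entry row j ≡ 0
    row-zero j = cong count (row-empty j)
    column-zero : ∀ i → entry i column ≡ 0
    column-zero i = cong count (column-empty i)

stretch : {P : Matrix k l} → NoZeroLine P → ∀ e (M : Matrix m n) → EmptyCross M → Saturating M P →
          Σ (Matrix (e + m) (e + n)) λ N → EmptyCross N × Saturating N P × weight N ≡ weight M
stretch P-lines zero    M cross sat = M , cross , sat , refl
stretch P-lines (suc e) M cross sat with stretch P-lines e M cross sat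
... | N , crossN , satN , weightN =
  duplicate N crossN , duplicate-emptyCross N crossN ,
  duplicate-saturating N crossN P-lines satN , trans (weight-duplicate N crossN) weightN

-- Deciding containment of Q

-- Checks are stated as does a? ≡ _ and closed by refl, which Agda evaluates far more
-- cheaply than True a?.
decided-yes : {A : Set} (a? : Dec A) → does a? ≡ true → A
decided-yes (yes a) _ = a

decided-no : {A : Set} (a? : Dec A) → does a? ≡ false → ¬ A
decided-no (no ¬a) _ = ¬a

Embeds : Matrix m n → Matrix k l → (Fin k → Fin m) → (Fin l → Fin n) → Set
Embeds M P r c = StrictlyIncreasing r × StrictlyIncreasing c × (∀ a b → P a b ≡ true → M (r a) (c b) ≡ true)

embeds? : (M : Matrix m n) (P : Matrix k l) (r : Fin k → Fin m) (c : Fin l → Fin n) → Dec (Embeds M P r c)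
embeds? M P r c =
  increasing? r ×-dec increasing? c ×-dec all? λ a → all? λ b → P a b ≟ᵇ true →-dec M (r a) (c b) ≟ᵇ true
  where
  increasing? : (f : Fin s → Fin t) → Dec (StrictlyIncreasing f)
  increasing? f = all? λ a → all? λ b → a <ᶠ? b →-dec f a <ᶠ? f b

increasing-by-steps : (f : Fin (suc k) → Fin m) → (∀ a → f (inject₁ a) <ᶠ f (suc a)) → StrictlyIncreasing f
increasing-by-steps f step zero (suc zero) _ = step zero
increasing-by-steps {suc k} f step zero (suc (suc b)) _ =
  <-trans (step zero) (increasing-by-steps (f ∘ suc) (step ∘ suc) zero (suc b) z<s)
increasing-by-steps {suc k} f step (suc a) (suc b) a<b =
  increasing-by-steps (f ∘ suc) (step ∘ suc) a b (s<s⁻¹ a<b)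

Q-column : Fin 5 → Fin 5
Q-column 0F = 1F
Q-column 1F = 4F
Q-column 2F = 2F
Q-column 3F = 0F
Q-column 4F = 3F

Q-graph : ∀ a b → Q a b ≡ true → Q-column a ≡ b
Q-graph = decided-yes (all? λ a → all? λ b → Q a b ≟ᵇ true →-dec Q-column a ≟ᶠ b) refl

Q-noZeroLine : NoZeroLine Q
Q-noZeroLine = decided-yes
  ((all? λ a → any? λ b → Q a b ≟ᵇ true) ×-dec (all? λ b → any? λ a → Q a b ≟ᵇ true)) refl

-- Subscripts are the row and column indices in Q; the nesting order is the search order.
QOccurrence : Matrix m n → Set
QOccurrence M =
  ∃[ r₀ ] ∃[ c₁ ] M r₀ c₁ ≡ true ×
  ∃[ r₁ ] r₀ <ᶠ r₁ × ∃[ c₄ ] c₁ <ᶠ c₄ × M r₁ c₄ ≡ true ×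
  ∃[ r₂ ] r₁ <ᶠ r₂ × ∃[ c₂ ] c₁ <ᶠ c₂ × c₂ <ᶠ c₄ × M r₂ c₂ ≡ true ×
  ∃[ r₃ ] r₂ <ᶠ r₃ × ∃[ c₀ ] c₀ <ᶠ c₁ × M r₃ c₀ ≡ true ×
  ∃[ r₄ ] r₃ <ᶠ r₄ × ∃[ c₃ ] c₂ <ᶠ c₃ × c₃ <ᶠ c₄ × M r₄ c₃ ≡ true

qOccurrence? : (M : Matrix m n) → Dec (QOccurrence M)
qOccurrence? M =
  any? λ r₀ → any? λ c₁ → M r₀ c₁ ≟ᵇ true ×-dec
  any? λ r₁ → r₀ <ᶠ? r₁ ×-dec any? λ c₄ → c₁ <ᶠ? c₄ ×-dec M r₁ c₄ ≟ᵇ true ×-dec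
  any? λ r₂ → r₁ <ᶠ? r₂ ×-dec any? λ c₂ → c₁ <ᶠ? c₂ ×-dec c₂ <ᶠ? c₄ ×-dec M r₂ c₂ ≟ᵇ true ×-dec
  any? λ r₃ → r₂ <ᶠ? r₃ ×-dec any? λ c₀ → c₀ <ᶠ? c₁ ×-dec M r₃ c₀ ≟ᵇ true ×-dec
  any? λ r₄ → r₃ <ᶠ? r₄ ×-dec any? λ c₃ → c₂ <ᶠ? c₃ ×-dec c₃ <ᶠ? c₄ ×-dec M r₄ c₃ ≟ᵇ true

qOccurrence⇒contains : {M : Matrix m n} → QOccurrence M → Contains M Q
qOccurrence⇒contains {M = M}
  ( r₀ , c₁ , h₀ , r₁ , r₀<r₁ , c₄ , c₁<c₄ , h₁ , r₂ , r₁<r₂ , c₂ , c₁<c₂ , c₂<c₄ , h₂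
  , r₃ , r₂<r₃ , c₀ , c₀<c₁ , h₃ , r₄ , r₃<r₄ , c₃ , c₂<c₃ , c₃<c₄ , h₄ ) =
  r , c , increasing-by-steps r r-steps , increasing-by-steps c c-steps , hit
  where
  r c : Fin 5 → _
  r = lookup (r₀ ∷ r₁ ∷ r₂ ∷ r₃ ∷ r₄ ∷ [])
  c = lookup (c₀ ∷ c₁ ∷ c₂ ∷ c₃ ∷ c₄ ∷ [])

  r-steps : ∀ a → r (inject₁ a) <ᶠ r (suc a)
  r-steps 0F = r₀<r₁
  r-steps 1F = r₁<r₂
  r-steps 2F = r₂<r₃
  r-steps 3F = r₃<r₄

  c-steps : ∀ a → c (inject₁ a) <ᶠ c (suc a)
  c-steps 0F = c₀<c₁
  c-steps 1F = c₁<c₂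
  c-steps 2F = c₂<c₃
  c-steps 3F = c₃<c₄

  hit-graph : ∀ a → M (r a) (c (Q-column a)) ≡ true
  hit-graph 0F = h₀
  hit-graph 1F = h₁
  hit-graph 2F = h₂
  hit-graph 3F = h₃
  hit-graph 4F = h₄

  hit : ∀ a b → Q a b ≡ true → M (r a) (c b) ≡ true
  hit a b Q-hit = subst (λ b → M (r a) (c b) ≡ true) (Q-graph a b Q-hit) (hit-graph a)

contains⇒qOccurrence : {M : Matrix m n} → Contains M Q → QOccurrence M
contains⇒qOccurrence (r , c , r↑ , c↑ , hit) =
  r 0F , c 1F , hit 0F 1F refl ,
  r 1F , r↑ 0F 1F z<s , c 4F , c↑ 1F 4F (s<s z<s) , hit 1F 4F refl ,
  r 2F , r↑ 1F 2F (s<s z<s) , c 2F , c↑ 1F 2F (s<s z<s) , c↑ 2F 4F (s<s (s<s z<s)) , hit 2F 2F refl ,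
  r 3F , r↑ 2F 3F (s<s (s<s z<s)) , c 0F , c↑ 0F 1F z<s , hit 3F 0F refl ,
  r 4F , r↑ 3F 4F (s<s (s<s (s<s z<s))) , c 3F , c↑ 2F 3F (s<s (s<s z<s)) ,
  c↑ 3F 4F (s<s (s<s (s<s z<s))) , hit 4F 3F refl

contains-Q? : (M : Matrix m n) → Dec (Contains M Q)
contains-Q? M = map′ qOccurrence⇒contains contains⇒qOccurrence (qOccurrence? M)

-- The 10 × 10 seed

W : Matrix 10 10
W i j = lookup (lookup rows i) j
  where
  ■ □ : Bool
  ■ = true
  □ = false
  rows = (■ ∷ ■ ∷ □ ∷ ■ ∷ ■ ∷ □ ∷ ■ ∷ ■ ∷ ■ ∷ ■ ∷ [])
       ∷ (■ ∷ ■ ∷ □ ∷ ■ ∷ ■ ∷ □ ∷ ■ ∷ □ ∷ □ ∷ □ ∷ [])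
       ∷ (■ ∷ ■ ∷ □ ∷ ■ ∷ ■ ∷ □ ∷ ■ ∷ ■ ∷ ■ ∷ ■ ∷ [])
       ∷ (□ ∷ ■ ∷ ■ ∷ ■ ∷ □ ∷ □ ∷ □ ∷ ■ ∷ ■ ∷ ■ ∷ [])
       ∷ (□ ∷ □ ∷ □ ∷ □ ∷ □ ∷ □ ∷ □ ∷ □ ∷ □ ∷ □ ∷ [])
       ∷ (□ ∷ ■ ∷ ■ ∷ ■ ∷ □ ∷ □ ∷ □ ∷ ■ ∷ ■ ∷ ■ ∷ [])
       ∷ (□ ∷ ■ ∷ ■ ∷ ■ ∷ ■ ∷ □ ∷ ■ ∷ ■ ∷ □ ∷ ■ ∷ [])
       ∷ (□ ∷ □ ∷ □ ∷ □ ∷ ■ ∷ □ ∷ ■ ∷ ■ ∷ □ ∷ ■ ∷ [])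
       ∷ (□ ∷ □ ∷ □ ∷ ■ ∷ ■ ∷ □ ∷ ■ ∷ ■ ∷ □ ∷ ■ ∷ [])
       ∷ (■ ∷ ■ ∷ ■ ∷ ■ ∷ ■ ∷ □ ∷ ■ ∷ □ ∷ □ ∷ ■ ∷ [])
       ∷ []

-- An entry (i , j , rows , columns) lists the rows and columns of an occurrence of Q in
-- flipOn W i j, one for each zero entry (i , j) of W.
W-Certificate : Set
W-Certificate = Fin 10 × Fin 10 × Vec (Fin 10) 5 × Vec (Fin 10) 5

W-certificates : List W-Certificate
W-certificates =
    (0F , 2F , (0F ∷ 1F ∷ 2F ∷ 3F ∷ 6F ∷ []) , (1F ∷ 2F ∷ 3F ∷ 4F ∷ 6F ∷ []))
  ∷ (0F , 5F , (0F ∷ 2F ∷ 6F ∷ 7F ∷ 8F ∷ []) , (4F ∷ 5F ∷ 6F ∷ 7F ∷ 8F ∷ []))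
  ∷ (1F , 2F , (1F ∷ 2F ∷ 3F ∷ 5F ∷ 6F ∷ []) , (1F ∷ 2F ∷ 3F ∷ 4F ∷ 6F ∷ []))
  ∷ (1F , 5F , (1F ∷ 2F ∷ 6F ∷ 7F ∷ 8F ∷ []) , (4F ∷ 5F ∷ 6F ∷ 7F ∷ 8F ∷ []))
  ∷ (1F , 7F , (0F ∷ 1F ∷ 2F ∷ 3F ∷ 6F ∷ []) , (1F ∷ 3F ∷ 4F ∷ 6F ∷ 7F ∷ []))
  ∷ (1F , 8F , (0F ∷ 1F ∷ 2F ∷ 3F ∷ 5F ∷ []) , (1F ∷ 3F ∷ 4F ∷ 7F ∷ 8F ∷ []))
  ∷ (1F , 9F , (0F ∷ 1F ∷ 2F ∷ 3F ∷ 5F ∷ []) , (1F ∷ 3F ∷ 4F ∷ 7F ∷ 9F ∷ []))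
  ∷ (2F , 2F , (2F ∷ 3F ∷ 5F ∷ 6F ∷ 7F ∷ []) , (1F ∷ 2F ∷ 3F ∷ 4F ∷ 7F ∷ []))
  ∷ (2F , 5F , (2F ∷ 3F ∷ 6F ∷ 7F ∷ 8F ∷ []) , (4F ∷ 5F ∷ 6F ∷ 7F ∷ 8F ∷ []))
  ∷ (3F , 0F , (0F ∷ 1F ∷ 2F ∷ 3F ∷ 6F ∷ []) , (0F ∷ 1F ∷ 3F ∷ 4F ∷ 6F ∷ []))
  ∷ (3F , 4F , (0F ∷ 2F ∷ 3F ∷ 5F ∷ 6F ∷ []) , (1F ∷ 3F ∷ 4F ∷ 6F ∷ 7F ∷ []))
  ∷ (3F , 5F , (0F ∷ 2F ∷ 3F ∷ 5F ∷ 6F ∷ []) , (1F ∷ 3F ∷ 5F ∷ 6F ∷ 7F ∷ []))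
  ∷ (3F , 6F , (0F ∷ 2F ∷ 3F ∷ 5F ∷ 6F ∷ []) , (1F ∷ 3F ∷ 6F ∷ 7F ∷ 8F ∷ []))
  ∷ (4F , 0F , (0F ∷ 1F ∷ 3F ∷ 4F ∷ 5F ∷ []) , (0F ∷ 1F ∷ 2F ∷ 3F ∷ 4F ∷ []))
  ∷ (4F , 1F , (0F ∷ 2F ∷ 3F ∷ 4F ∷ 5F ∷ []) , (1F ∷ 3F ∷ 7F ∷ 8F ∷ 9F ∷ []))
  ∷ (4F , 2F , (0F ∷ 2F ∷ 3F ∷ 4F ∷ 5F ∷ []) , (2F ∷ 3F ∷ 7F ∷ 8F ∷ 9F ∷ []))
  ∷ (4F , 3F , (0F ∷ 2F ∷ 3F ∷ 4F ∷ 5F ∷ []) , (3F ∷ 4F ∷ 7F ∷ 8F ∷ 9F ∷ []))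
  ∷ (4F , 4F , (0F ∷ 2F ∷ 4F ∷ 5F ∷ 6F ∷ []) , (1F ∷ 3F ∷ 4F ∷ 6F ∷ 7F ∷ []))
  ∷ (4F , 5F , (0F ∷ 1F ∷ 2F ∷ 3F ∷ 4F ∷ []) , (1F ∷ 3F ∷ 4F ∷ 5F ∷ 6F ∷ []))
  ∷ (4F , 6F , (0F ∷ 2F ∷ 4F ∷ 5F ∷ 6F ∷ []) , (1F ∷ 3F ∷ 6F ∷ 7F ∷ 8F ∷ []))
  ∷ (4F , 7F , (3F ∷ 4F ∷ 5F ∷ 6F ∷ 7F ∷ []) , (1F ∷ 2F ∷ 3F ∷ 4F ∷ 7F ∷ []))
  ∷ (4F , 8F , (3F ∷ 4F ∷ 5F ∷ 6F ∷ 7F ∷ []) , (1F ∷ 2F ∷ 3F ∷ 4F ∷ 8F ∷ []))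
  ∷ (4F , 9F , (3F ∷ 4F ∷ 5F ∷ 6F ∷ 7F ∷ []) , (1F ∷ 2F ∷ 3F ∷ 4F ∷ 9F ∷ []))
  ∷ (5F , 0F , (0F ∷ 1F ∷ 3F ∷ 5F ∷ 6F ∷ []) , (0F ∷ 1F ∷ 2F ∷ 3F ∷ 4F ∷ []))
  ∷ (5F , 4F , (0F ∷ 2F ∷ 5F ∷ 6F ∷ 7F ∷ []) , (1F ∷ 3F ∷ 4F ∷ 6F ∷ 7F ∷ []))
  ∷ (5F , 5F , (0F ∷ 1F ∷ 2F ∷ 3F ∷ 5F ∷ []) , (1F ∷ 3F ∷ 4F ∷ 5F ∷ 6F ∷ []))
  ∷ (5F , 6F , (0F ∷ 2F ∷ 5F ∷ 6F ∷ 7F ∷ []) , (1F ∷ 3F ∷ 6F ∷ 7F ∷ 8F ∷ []))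
  ∷ (6F , 0F , (0F ∷ 1F ∷ 3F ∷ 6F ∷ 8F ∷ []) , (0F ∷ 1F ∷ 2F ∷ 3F ∷ 4F ∷ []))
  ∷ (6F , 5F , (0F ∷ 1F ∷ 2F ∷ 3F ∷ 6F ∷ []) , (1F ∷ 3F ∷ 4F ∷ 5F ∷ 6F ∷ []))
  ∷ (6F , 8F , (0F ∷ 2F ∷ 3F ∷ 5F ∷ 6F ∷ []) , (1F ∷ 3F ∷ 7F ∷ 8F ∷ 9F ∷ []))
  ∷ (7F , 0F , (0F ∷ 1F ∷ 3F ∷ 7F ∷ 8F ∷ []) , (0F ∷ 1F ∷ 2F ∷ 3F ∷ 4F ∷ []))
  ∷ (7F , 1F , (0F ∷ 2F ∷ 6F ∷ 7F ∷ 8F ∷ []) , (1F ∷ 3F ∷ 4F ∷ 6F ∷ 7F ∷ []))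
  ∷ (7F , 2F , (0F ∷ 2F ∷ 6F ∷ 7F ∷ 8F ∷ []) , (2F ∷ 3F ∷ 4F ∷ 6F ∷ 7F ∷ []))
  ∷ (7F , 3F , (0F ∷ 2F ∷ 6F ∷ 7F ∷ 8F ∷ []) , (3F ∷ 4F ∷ 6F ∷ 7F ∷ 8F ∷ []))
  ∷ (7F , 5F , (0F ∷ 1F ∷ 2F ∷ 3F ∷ 7F ∷ []) , (1F ∷ 3F ∷ 4F ∷ 5F ∷ 6F ∷ []))
  ∷ (7F , 8F , (0F ∷ 2F ∷ 3F ∷ 5F ∷ 7F ∷ []) , (1F ∷ 3F ∷ 7F ∷ 8F ∷ 9F ∷ []))
  ∷ (8F , 0F , (0F ∷ 1F ∷ 3F ∷ 8F ∷ 9F ∷ []) , (0F ∷ 1F ∷ 2F ∷ 3F ∷ 4F ∷ []))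
  ∷ (8F , 1F , (0F ∷ 2F ∷ 6F ∷ 8F ∷ 9F ∷ []) , (1F ∷ 3F ∷ 4F ∷ 6F ∷ 7F ∷ []))
  ∷ (8F , 2F , (0F ∷ 2F ∷ 6F ∷ 8F ∷ 9F ∷ []) , (2F ∷ 3F ∷ 4F ∷ 6F ∷ 7F ∷ []))
  ∷ (8F , 5F , (0F ∷ 1F ∷ 2F ∷ 3F ∷ 8F ∷ []) , (1F ∷ 3F ∷ 4F ∷ 5F ∷ 6F ∷ []))
  ∷ (8F , 8F , (0F ∷ 2F ∷ 3F ∷ 5F ∷ 8F ∷ []) , (1F ∷ 3F ∷ 7F ∷ 8F ∷ 9F ∷ []))
  ∷ (9F , 5F , (0F ∷ 1F ∷ 2F ∷ 3F ∷ 9F ∷ []) , (1F ∷ 3F ∷ 4F ∷ 5F ∷ 6F ∷ []))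
  ∷ (9F , 7F , (0F ∷ 2F ∷ 6F ∷ 8F ∷ 9F ∷ []) , (3F ∷ 4F ∷ 6F ∷ 7F ∷ 8F ∷ []))
  ∷ (9F , 8F , (0F ∷ 2F ∷ 3F ∷ 5F ∷ 9F ∷ []) , (1F ∷ 3F ∷ 7F ∷ 8F ∷ 9F ∷ []))
  ∷ []

Certifies : Fin 10 → Fin 10 → W-Certificate → Set
Certifies i j (i′ , j′ , rows , columns) =
  i′ ≡ i × j′ ≡ j × Embeds (flipOn W i j) Q (lookup rows) (lookup columns)

-- Abstract, so that later with-abstractions do not rerun these exhaustive checks.
abstract
  W-avoids : Avoids W Q
  W-avoids = decided-no (contains-Q? W) refl

  W-certified : ∀ i j → W i j ≡ false → Any (Certifies i j) W-certificates
  W-certified = decided-yes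
    (all? λ i → all? λ j → W i j ≟ᵇ false →-dec
       anyᴸ? (λ (i′ , j′ , rows , columns) →
         i′ ≟ᶠ i ×-dec j′ ≟ᶠ j ×-dec embeds? (flipOn W i j) Q (lookup rows) (lookup columns))
       W-certificates)
    refl

W-flips : ∀ i j → W i j ≡ false → Contains (flipOn W i j) Q
W-flips i j miss with satisfied (W-certified i j miss)
... | (_ , _ , rows , columns) , (_ , _ , embeds) = lookup rows , lookup columns , embeds

W-saturating : Saturating W Q
W-saturating = W-avoids , W-flips

W-emptyCross : EmptyCross W
W-emptyCross = record
  { row          = 4F
  ; column       = 5F
  ; row-empty    = decided-yes (all? λ j → W 4F j ≟ᵇ false) refl
  ; column-empty = decided-yes (all? λ i → W i 5F ≟ᵇ false) refl
  }

W-weight : weight W ≡ 56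
W-weight = refl

SaturatingUnder400 : ℕ → Set
SaturatingUnder400 k = Σ (Matrix k k) λ M → Saturating M Q × weight M < 400

saturatingUnder400-small : n < 9 → SaturatingUnder400 (suc n)
saturatingUnder400-small n<9 with Greedy.saturating-exists contains-Q? {a = 0F} {b = 1F} refl
... | M , saturated =
  M , saturated , ≤-<-trans (≤-trans (weight-≤ M) (*-mono-≤ n<9 n<9)) (from-yes (81 <? 400))

saturatingUnder400-large : ∀ e → SaturatingUnder400 (e + 10)
saturatingUnder400-large e with stretch Q-noZeroLine e W W-emptyCross W-saturating
... | N , _ , saturated , weight≡ =
  N , saturated , subst (_< 400) (sym (trans weight≡ W-weight)) (from-yes (56 <? 400))

theorem3 : (n : ℕ) → Σ (Matrix (suc n) (suc n)) λ M → Saturating M Q × weight M < 400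
theorem3 n with n <? 9
... | yes n<9 = saturatingUnder400-small n<9
... | no n≮9 with m≤n⇒∃[o]m+o≡n (≮⇒≥ n≮9)
...   | e , refl = subst SaturatingUnder400 (+-comm e 10) (saturatingUnder400-large e)
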